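{- Let $\mathcal A=\langle A;\Xi\rangle$ be an algebra and $L\subseteq A$ be $\mathcal A$-recognizable. Then $\mathrm{Bool}^{\infty}_{\mathcal A}(L)$ is finite, every set in it is $\mathcal A$-recognizable, and $\mathrm{Latt}^{\emptyset,A}_{\mathcal A}(L)=\mathrm{Latt}^{\infty}_{\mathcal A}(L)$ and $\mathrm{Bool}^{\emptyset,A}_{\mathcal A}(L)=\mathrm{Bool}^{\infty}_{\mathcal A}(L)$.
   Context: An algebra $\mathcal A=\langle A;\Xi\rangle$ is a nonempty set with operations; an $\mathcal A$-congruence is an equivalence relation compatible with every operation; $L$ is $\mathcal A$-recognizable if it is a union of classes of some $\mathcal A$-congruence with finitely many classes. The 1-freezifications of an operation $\xi$ of arity $n\ge2$ are the maps $x\mapsto\xi(c_1,\dots,c_{i-1},x,c_{i+1},\dots,c_n)$ with $c_j\in A$; a unary operation is its own 1-freezification; $\mathrm{Freez}^*(\mathcal A)$ is the set of finite (possibly empty) compositions of 1-freezifications. For $L\subseteq A$: $\mathrm{Latt}^{\emptyset,A}_{\mathcal A}(L)$ (resp. $\mathrm{Bool}^{\emptyset,A}_{\mathcal A}(L)$) is the smallest family of subsets of $A$ containing $L,\emptyset,A$ closed under finite unions and intersections (resp. and complementation) and under $X\mapsto\gamma^{ -1}(X)$ for all $\gamma\in\mathrm{Freez}^*(\mathcal A)$; $\mathrm{Latt}^{\infty}_{\mathcal A}(L)$ (resp. $\mathrm{Bool}^{\infty}_{\mathcal A}(L)$) is the smallest family containing $L$ closed under arbitrary (including empty) unions and intersections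 (resp. and complementation) and under all $\gamma^{ -1}$. -}

module Defs where

open import Level using (0ℓ)
open import Data.Nat using (ℕ)
open import Data.Fin using (Fin; _≟_)
open import Data.List using (List; []; _∷_)
open import Data.Product using (Σ; ∃; _×_; _,_)
open import Data.Sum using (_⊎_)
open import Data.Empty using (⊥)
open import Data.Unit using (⊤)
open import Relation.Nullary using (¬_; yes; no)
open import Relation.Binary using (Rel; IsEquivalence)

record Algebra : Set₁ where
  field
    Carrier  : Set
    Op       : Set
    arity    : Op → ℕ
    ⟦_⟧      : (o : Op) → (Fin (arity o) → Carrier) → Carrier
    nonempty : Carrier

module _ (𝒜 : Algebra) where
  open Algebra 𝒜

  Subset : Set₁
  Subset = Carrier → Set

  _≐_ : Subset → Subset → Set
  X ≐ Y = ∀ a → (X a → Y a) × (Y a → X a)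

  put : ∀ {n} → (Fin n → Carrier) → Fin n → Carrier → Fin n → Carrier
  put c i x j with j ≟ i
  ... | yes _ = x
  ... | no  _ = c j

  -- a 1-freezification: x ↦ o(c₁,…,c_{i-1},x,c_{i+1},…,c_n)
  -- (for a unary o this is o itself; nullary operations have none)
  record Freez1 : Set where
    constructor freez
    field
      op     : Op
      pos    : Fin (arity op)
      consts : Fin (arity op) → Carrier

  apply1 : Freez1 → Carrier → Carrier
  apply1 (freez o i c) x = ⟦ o ⟧ (put c i x)

  Freez* : Set
  Freez* = List Freez1

  apply* : Freez* → Carrier → Carrier
  apply* []      x = x
  apply* (g ∷ γ) x = apply1 g (apply* γ x)

  preimage : Freez* → Subset → Subset
  preimage γ X a = X (apply* γ a)

  record Congruence : Set₁ where
    field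
      _≈_        : Rel Carrier 0ℓ
      isEquiv    : IsEquivalence _≈_
      compatible : ∀ (o : Op) (xs ys : Fin (arity o) → Carrier) →
                   (∀ j → xs j ≈ ys j) → ⟦ o ⟧ xs ≈ ⟦ o ⟧ ys

  FinitelyManyClasses : Congruence → Set
  FinitelyManyClasses θ = Σ ℕ λ n → Σ (Fin n → Carrier) λ r →
    ∀ a → ∃ λ i → Congruence._≈_ θ a (r i)

  UnionOfClasses : Congruence → Subset → Set
  UnionOfClasses θ X = ∀ a b → Congruence._≈_ θ a b → X a → X b

  Recognizable : Subset → Set₁
  Recognizable X = Σ Congruence λ θ → FinitelyManyClasses θ × UnionOfClasses θ X

  data Latt∅A (L : Subset) : Subset → Set₁ where
    base  : Latt∅A L L
    empty : Latt∅A L (λ _ → ⊥)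
    full  : Latt∅A L (λ _ → ⊤)
    union : ∀ {X Y} → Latt∅A L X → Latt∅A L Y → Latt∅A L (λ a → X a ⊎ Y a)
    inter : ∀ {X Y} → Latt∅A L X → Latt∅A L Y → Latt∅A L (λ a → X a × Y a)
    pre   : ∀ {X} (γ : Freez*) → Latt∅A L X → Latt∅A L (preimage γ X)
    ext   : ∀ {X Y} → X ≐ Y → Latt∅A L X → Latt∅A L Y

  data Bool∅A (L : Subset) : Subset → Set₁ where
    base  : Bool∅A L L
    empty : Bool∅A L (λ _ → ⊥)
    full  : Bool∅A L (λ _ → ⊤)
    union : ∀ {X Y} → Bool∅A L X → Bool∅A L Y → Bool∅A L (λ a → X a ⊎ Y a)
    inter : ∀ {X Y} → Bool∅A L X → Bool∅A L Y → Bool∅A L (λ a → X a × Y a)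
    compl : ∀ {X} → Bool∅A L X → Bool∅A L (λ a → ¬ X a)
    pre   : ∀ {X} (γ : Freez*) → Bool∅A L X → Bool∅A L (preimage γ X)
    ext   : ∀ {X Y} → X ≐ Y → Bool∅A L X → Bool∅A L Y

  -- Latt^∞(L): arbitrary (incl. empty) unions/intersections indexed by any I : Set
  data Latt∞ (L : Subset) : Subset → Set₁ where
    base   : Latt∞ L L
    unions : (I : Set) (F : I → Subset) → (∀ i → Latt∞ L (F i)) →
             Latt∞ L (λ a → Σ I λ i → F i a)
    inters : (I : Set) (F : I → Subset) → (∀ i → Latt∞ L (F i)) →
             Latt∞ L (λ a → ∀ i → F i a)
    pre    : ∀ {X} (γ : Freez*) → Latt∞ L X → Latt∞ L (preimage γ X)
    ext    : ∀ {X Y} → X ≐ Y → Latt∞ L X → Latt∞ L Y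

  data Bool∞ (L : Subset) : Subset → Set₁ where
    base   : Bool∞ L L
    unions : (I : Set) (F : I → Subset) → (∀ i → Bool∞ L (F i)) →
             Bool∞ L (λ a → Σ I λ i → F i a)
    inters : (I : Set) (F : I → Subset) → (∀ i → Bool∞ L (F i)) →
             Bool∞ L (λ a → ∀ i → F i a)
    compl  : ∀ {X} → Bool∞ L X → Bool∞ L (λ a → ¬ X a)
    pre    : ∀ {X} (γ : Freez*) → Bool∞ L X → Bool∞ L (preimage γ X)
    ext    : ∀ {X Y} → X ≐ Y → Bool∞ L X → Bool∞ L Y

  FiniteFamily : (Subset → Set₁) → Set₁
  FiniteFamily 𝓕 = Σ ℕ λ n → Σ (Fin n → Subset) λ S →
    (∀ i → 𝓕 (S i)) × (∀ X → 𝓕 X → ∃ λ i → X ≐ S i)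

  SameFamily : (Subset → Set₁) → (Subset → Set₁) → Set₁
  SameFamily 𝓕 𝓖 = ∀ X → (𝓕 X → 𝓖 X) × (𝓖 X → 𝓕 X)

-- Write a ⊑ b when every preimage γ⁻¹(L), γ ∈ Freez*, that contains a also contains b.
-- Sets in Latt∞(L) are up-closed for ⊑ and sets in Bool∞(L) are unions of ⊑-equivalence
-- classes, since both properties survive arbitrary unions, intersections, preimages and (for
-- the second) complements. A congruence θ with finitely many classes that recognizes L
-- is contained in ⊑. Hence each principal up-set ↑a is the intersection of one separating
-- preimage γ⁻¹(L) per θ-class lying outside ↑a, and every up-closed set is the union of the
-- ↑r over its finitely many θ-class representatives r; likewise with equivalence classes in
-- the Boolean case. So the infinitary families already lie in the finitary ones, and a set in
-- Bool∞(L) is determined by the representatives it contains, which leaves at most 2ⁿ sets.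
module Submission where

open import Level using (0ℓ)
open import Data.Product using (_×_)
open import Axiom.ExcludedMiddle using (ExcludedMiddle)
open import Defs

open import Axiom.DoubleNegationElimination using (em⇒dne)
open import Data.Bool using (Bool; true; false; if_then_else_)
open import Data.Empty using (⊥; ⊥-elim)
open import Data.Fin using (Fin; zero; suc; _≟_; funToFin; finToFun)
open import Data.Fin.Properties using (finToFun-funToFin)
open import Data.List using ([]; _∷_; _++_)
open import Data.Nat using (ℕ; zero; suc; _^_)
open import Data.Product using (Σ; ∃; _,_; proj₁; proj₂)
open import Data.Sum using (inj₁; inj₂)
open import Function using (_∘_)
open import Relation.Binary using (Rel; IsEquivalence)
open import Relation.Binary.Definitions using (_Respects_)
open import Relation.Binary.PropositionalEquality using (_≡_; refl; cong; subst; sym; trans)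
open import Relation.Nullary using (¬_; Dec; yes; no)
open import Relation.Unary using (∅; U; _∪_; _∩_; ⋃; ⋂; _⊆_)

fromDec : {P : Set} → Dec P → Fin 2
fromDec (yes _) = zero
fromDec (no _)  = suc zero

fromDec≡zero⇒ : {P : Set} (d : Dec P) → fromDec d ≡ zero → P
fromDec≡zero⇒ (yes p) _ = p

⇒fromDec≡zero : {P : Set} (d : Dec P) → P → fromDec d ≡ zero
⇒fromDec≡zero (yes _) _ = refl
⇒fromDec≡zero (no ¬p) p = ⊥-elim (¬p p)

module _ (𝒜 : Algebra) where
  open Algebra 𝒜

  ⊆-antisym : {X Y : Subset 𝒜} → X ⊆ Y → Y ⊆ X → _≐_ 𝒜 X Y
  ⊆-antisym X⊆Y Y⊆X _ = X⊆Y , Y⊆X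

  record IsSetLattice (𝓕 : Subset 𝒜 → Set₁) : Set₁ where
    field
      ≐-closed : ∀ {X Y} → _≐_ 𝒜 X Y → 𝓕 X → 𝓕 Y
      ∅-closed : 𝓕 ∅
      U-closed : 𝓕 U
      ∪-closed : ∀ {X Y} → 𝓕 X → 𝓕 Y → 𝓕 (X ∪ Y)
      ∩-closed : ∀ {X Y} → 𝓕 X → 𝓕 Y → 𝓕 (X ∩ Y)

    ⋃-closed : ∀ {m} (F : Fin m → Subset 𝒜) → (∀ j → 𝓕 (F j)) → 𝓕 (⋃ (Fin m) F)
    ⋃-closed {zero}  F F∈ = ≐-closed (⊆-antisym (λ ()) (λ ())) ∅-closed
    ⋃-closed {suc m} F F∈ =
      ≐-closed (⊆-antisym (λ { (inj₁ x) → zero , x ; (inj₂ (j , x)) → suc j , x })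
                          (λ { (zero , x) → inj₁ x ; (suc j , x) → inj₂ (j , x) }))
               (∪-closed (F∈ zero) (⋃-closed (F ∘ suc) (F∈ ∘ suc)))

    ⋂-closed : ∀ {m} (F : Fin m → Subset 𝒜) → (∀ j → 𝓕 (F j)) → 𝓕 (⋂ (Fin m) F)
    ⋂-closed {zero}  F F∈ = ≐-closed (⊆-antisym (λ _ ()) _) U-closed
    ⋂-closed {suc m} F F∈ =
      ≐-closed (⊆-antisym (λ { (x , xs) zero → x ; (x , xs) (suc j) → xs j })
                          (λ xs → xs zero , xs ∘ suc))
               (∩-closed (F∈ zero) (⋂-closed (F ∘ suc) (F∈ ∘ suc)))

    guard-closed : ∀ {P : Set} {X} → Dec P → 𝓕 X → 𝓕 (λ a → P × X a)
    guard-closed (yes p) X∈ = ≐-closed (⊆-antisym (p ,_) proj₂) X∈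
    guard-closed (no ¬p) X∈ = ≐-closed (⊆-antisym (λ ()) (¬p ∘ proj₁)) ∅-closed

  complete⇒isSetLattice : {𝓕 : Subset 𝒜 → Set₁} →
    (∀ {X Y} → _≐_ 𝒜 X Y → 𝓕 X → 𝓕 Y) →
    (∀ (I : Set) F → (∀ i → 𝓕 (F i)) → 𝓕 (⋃ I F)) →
    (∀ (I : Set) F → (∀ i → 𝓕 (F i)) → 𝓕 (⋂ I F)) →
    IsSetLattice 𝓕
  complete⇒isSetLattice {𝓕} ≐-closed ⋃-closed ⋂-closed = record
    { ≐-closed = ≐-closed
    ; ∅-closed = ≐-closed (⊆-antisym (λ ()) (λ ())) (⋃-closed ⊥ ⊥-elim λ ())
    ; U-closed = ≐-closed (⊆-antisym _ (λ _ ())) (⋂-closed ⊥ ⊥-elim λ ())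
    ; ∪-closed = ∪-closed
    ; ∩-closed = ∩-closed
    }
    where
    pair : Subset 𝒜 → Subset 𝒜 → Bool → Subset 𝒜
    pair X Y b = if b then X else Y

    pair-closed : ∀ {X Y} → 𝓕 X → 𝓕 Y → ∀ b → 𝓕 (pair X Y b)
    pair-closed X∈ Y∈ true  = X∈
    pair-closed X∈ Y∈ false = Y∈

    ∪-closed : ∀ {X Y} → 𝓕 X → 𝓕 Y → 𝓕 (X ∪ Y)
    ∪-closed X∈ Y∈ =
      ≐-closed (⊆-antisym (λ { (true , x) → inj₁ x ; (false , y) → inj₂ y })
                          (λ { (inj₁ x) → true , x ; (inj₂ y) → false , y }))
               (⋃-closed Bool _ (pair-closed X∈ Y∈))

    ∩-closed : ∀ {X Y} → 𝓕 X → 𝓕 Y → 𝓕 (X ∩ Y)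
    ∩-closed X∈ Y∈ =
      ≐-closed (⊆-antisym (λ xy → xy true , xy false)
                          (λ { (x , y) true → x ; (x , y) false → y }))
               (⋂-closed Bool _ (pair-closed X∈ Y∈))

  apply*-++ : ∀ γ δ a → apply* 𝒜 (γ ++ δ) a ≡ apply* 𝒜 γ (apply* 𝒜 δ a)
  apply*-++ []      δ a = refl
  apply*-++ (g ∷ γ) δ a = cong (apply1 𝒜 g) (apply*-++ γ δ a)

  module _ (θ : Congruence 𝒜) where
    open Congruence θ
    open IsEquivalence isEquiv using () renaming (refl to ≈-refl)

    put-cong : ∀ {m} (c : Fin m → Carrier) i {a b} → a ≈ b → ∀ j → put 𝒜 c i a j ≈ put 𝒜 c i b j
    put-cong c i a≈b j with j ≟ i
    ... | yes _ = a≈b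
    ... | no  _ = ≈-refl

    apply*-cong : ∀ γ {a b} → a ≈ b → apply* 𝒜 γ a ≈ apply* 𝒜 γ b
    apply*-cong []                 a≈b = a≈b
    apply*-cong (freez o i c ∷ γ) a≈b = compatible o _ _ (put-cong c i (apply*-cong γ a≈b))

module Closures (𝒜 : Algebra) (L : Subset 𝒜) where

  latt∅A-isSetLattice : IsSetLattice 𝒜 (Latt∅A 𝒜 L)
  latt∅A-isSetLattice = record
    { ≐-closed = ext ; ∅-closed = empty ; U-closed = full ; ∪-closed = union ; ∩-closed = inter }

  bool∅A-isSetLattice : IsSetLattice 𝒜 (Bool∅A 𝒜 L)
  bool∅A-isSetLattice = record
    { ≐-closed = ext ; ∅-closed = empty ; U-closed = full ; ∪-closed = union ; ∩-closed = inter }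

  latt∞-isSetLattice : IsSetLattice 𝒜 (Latt∞ 𝒜 L)
  latt∞-isSetLattice = complete⇒isSetLattice 𝒜 ext unions inters

  bool∞-isSetLattice : IsSetLattice 𝒜 (Bool∞ 𝒜 L)
  bool∞-isSetLattice = complete⇒isSetLattice 𝒜 ext unions inters

  latt∅A⊆bool∅A : ∀ {X} → Latt∅A 𝒜 L X → Bool∅A 𝒜 L X
  latt∅A⊆bool∅A base        = base
  latt∅A⊆bool∅A empty       = empty
  latt∅A⊆bool∅A full        = full
  latt∅A⊆bool∅A (union X Y) = union (latt∅A⊆bool∅A X) (latt∅A⊆bool∅A Y)
  latt∅A⊆bool∅A (inter X Y) = inter (latt∅A⊆bool∅A X) (latt∅A⊆bool∅A Y)
  latt∅A⊆bool∅A (pre γ X)   = pre γ (latt∅A⊆bool∅A X)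
  latt∅A⊆bool∅A (ext e X)   = ext e (latt∅A⊆bool∅A X)

  private
    module L∞ = IsSetLattice latt∞-isSetLattice
    module B∞ = IsSetLattice bool∞-isSetLattice

  latt∅A⊆latt∞ : ∀ {X} → Latt∅A 𝒜 L X → Latt∞ 𝒜 L X
  latt∅A⊆latt∞ base        = base
  latt∅A⊆latt∞ empty       = L∞.∅-closed
  latt∅A⊆latt∞ full        = L∞.U-closed
  latt∅A⊆latt∞ (union X Y) = L∞.∪-closed (latt∅A⊆latt∞ X) (latt∅A⊆latt∞ Y)
  latt∅A⊆latt∞ (inter X Y) = L∞.∩-closed (latt∅A⊆latt∞ X) (latt∅A⊆latt∞ Y)
  latt∅A⊆latt∞ (pre γ X)   = pre γ (latt∅A⊆latt∞ X)
  latt∅A⊆latt∞ (ext e X)   = ext e (latt∅A⊆latt∞ X)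

  bool∅A⊆bool∞ : ∀ {X} → Bool∅A 𝒜 L X → Bool∞ 𝒜 L X
  bool∅A⊆bool∞ base        = base
  bool∅A⊆bool∞ empty       = B∞.∅-closed
  bool∅A⊆bool∞ full        = B∞.U-closed
  bool∅A⊆bool∞ (union X Y) = B∞.∪-closed (bool∅A⊆bool∞ X) (bool∅A⊆bool∞ Y)
  bool∅A⊆bool∞ (inter X Y) = B∞.∩-closed (bool∅A⊆bool∞ X) (bool∅A⊆bool∞ Y)
  bool∅A⊆bool∞ (compl X)   = compl (bool∅A⊆bool∞ X)
  bool∅A⊆bool∞ (pre γ X)   = pre γ (bool∅A⊆bool∞ X)
  bool∅A⊆bool∞ (ext e X)   = ext e (bool∅A⊆bool∞ X)

module SyntacticPreorder (𝒜 : Algebra) (L : Subset 𝒜) where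
  open Algebra 𝒜

  _⊑_ : Rel Carrier 0ℓ
  a ⊑ b = ∀ γ → L (apply* 𝒜 γ a) → L (apply* 𝒜 γ b)

  _~_ : Rel Carrier 0ℓ
  a ~ b = a ⊑ b × b ⊑ a

  ⊑-trans : ∀ {a b c} → a ⊑ b → b ⊑ c → a ⊑ c
  ⊑-trans a⊑b b⊑c γ = b⊑c γ ∘ a⊑b γ

  ~-trans : ∀ {a b c} → a ~ b → b ~ c → a ~ c
  ~-trans (a⊑b , b⊑a) (b⊑c , c⊑b) = ⊑-trans a⊑b b⊑c , ⊑-trans c⊑b b⊑a

  ⊑-apply* : ∀ δ {a b} → a ⊑ b → apply* 𝒜 δ a ⊑ apply* 𝒜 δ b
  ⊑-apply* δ {a} {b} a⊑b γ γδa∈L =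
    subst L (apply*-++ 𝒜 γ δ b) (a⊑b (γ ++ δ) (subst L (sym (apply*-++ 𝒜 γ δ a)) γδa∈L))

  latt∞-respects-⊑ : ∀ {X} → Latt∞ 𝒜 L X → X Respects _⊑_
  latt∞-respects-⊑ base            a⊑b a∈X        = a⊑b [] a∈X
  latt∞-respects-⊑ (unions I F F∈) a⊑b (i , a∈Fi) = i , latt∞-respects-⊑ (F∈ i) a⊑b a∈Fi
  latt∞-respects-⊑ (inters I F F∈) a⊑b a∈F i      = latt∞-respects-⊑ (F∈ i) a⊑b (a∈F i)
  latt∞-respects-⊑ (pre γ X)       a⊑b a∈X        = latt∞-respects-⊑ X (⊑-apply* γ a⊑b) a∈X
  latt∞-respects-⊑ (ext e X) {a} {b} a⊑b a∈Y     =
    proj₁ (e b) (latt∞-respects-⊑ X a⊑b (proj₂ (e a) a∈Y))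

  bool∞-respects-~ : ∀ {X} → Bool∞ 𝒜 L X → X Respects _~_
  bool∞-respects-~ base            a~b a∈X        = proj₁ a~b [] a∈X
  bool∞-respects-~ (unions I F F∈) a~b (i , a∈Fi) = i , bool∞-respects-~ (F∈ i) a~b a∈Fi
  bool∞-respects-~ (inters I F F∈) a~b a∈F i      = bool∞-respects-~ (F∈ i) a~b (a∈F i)
  bool∞-respects-~ (compl X) (a⊑b , b⊑a) a∉X b∈X  = a∉X (bool∞-respects-~ X (b⊑a , a⊑b) b∈X)
  bool∞-respects-~ (pre γ X) (a⊑b , b⊑a) a∈X      =
    bool∞-respects-~ X (⊑-apply* γ a⊑b , ⊑-apply* γ b⊑a) a∈X
  bool∞-respects-~ (ext e X) {a} {b} a~b a∈Y      =
    proj₁ (e b) (bool∞-respects-~ X a~b (proj₂ (e a) a∈Y))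

module Representatives (𝒜 : Algebra) (θ : Congruence 𝒜) (n : ℕ) (r : Fin n → Algebra.Carrier 𝒜)
                       (cover : ∀ a → ∃ λ j → Congruence._≈_ θ a (r j)) where
  open Algebra 𝒜
  open Congruence θ
  open IsEquivalence isEquiv using () renaming (sym to ≈-sym)

  ⋃-representatives : (R : Rel Carrier 0ℓ) → (∀ {a b} → a ≈ b → R a b) →
    ∀ {X} → X Respects R → _≐_ 𝒜 X (⋃ (Fin n) λ j a → X (r j) × R (r j) a)
  ⋃-representatives R ≈⇒R X-resp =
    ⊆-antisym 𝒜 (λ {a} a∈X → let (j , a≈rj) = cover a in
                               j , X-resp (≈⇒R a≈rj) a∈X , ≈⇒R (≈-sym a≈rj))
                (λ (j , rj∈X , rjRa) → X-resp rjRa rj∈X)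

  respects⇒∈ : ExcludedMiddle 0ℓ → ∀ {𝓕} → IsSetLattice 𝒜 𝓕 →
    (R : Rel Carrier 0ℓ) → (∀ {a b} → a ≈ b → R a b) → (∀ a → 𝓕 (R a)) →
    ∀ {X} → X Respects R → 𝓕 X
  respects⇒∈ em 𝓕-lattice R ≈⇒R cone∈ X-resp =
    ≐-closed (λ a → let (to , from) = ⋃-representatives R ≈⇒R X-resp a in from , to)
             (⋃-closed _ λ j → guard-closed em (cone∈ (r j)))
    where open IsSetLattice 𝓕-lattice

  ⋂-localization : ∀ {𝓕} → IsSetLattice 𝒜 𝓕 → ∀ {X} (S : Fin n → Subset 𝒜) → (∀ j → 𝓕 (S j)) →
    (∀ j → X ⊆ S j) → (∀ j → S j ∩ (_≈ r j) ⊆ X) → 𝓕 X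
  ⋂-localization 𝓕-lattice S S∈ X⊆S S∩class⊆X =
    ≐-closed (⊆-antisym 𝒜 (λ {a} a∈S → let (j , a≈rj) = cover a in S∩class⊆X j (a∈S j , a≈rj))
                          (λ a∈X j → X⊆S j a∈X))
             (⋂-closed S S∈)
    where open IsSetLattice 𝓕-lattice

module Recognized (em : ExcludedMiddle 0ℓ) (𝒜 : Algebra) (L : Subset 𝒜)
                  (θ : Congruence 𝒜) (n : ℕ) (r : Fin n → Algebra.Carrier 𝒜)
                  (cover : ∀ a → ∃ λ j → Congruence._≈_ θ a (r j))
                  (L-saturated : UnionOfClasses 𝒜 θ L) where
  open Algebra 𝒜
  open Congruence θ
  open Closures 𝒜 L
  open SyntacticPreorder 𝒜 L
  open Representatives 𝒜 θ n r cover
  open IsEquivalence isEquiv using () renaming (sym to ≈-sym)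

  ≈⇒⊑ : ∀ {a b} → a ≈ b → a ⊑ b
  ≈⇒⊑ a≈b γ = L-saturated _ _ (apply*-cong 𝒜 θ γ a≈b)

  ≈⇒~ : ∀ {a b} → a ≈ b → a ~ b
  ≈⇒~ a≈b = ≈⇒⊑ a≈b , ≈⇒⊑ (≈-sym a≈b)

  Separated : Carrier → Carrier → Set
  Separated a b = Σ (Freez* 𝒜) λ γ → L (apply* 𝒜 γ a) × ¬ L (apply* 𝒜 γ b)

  ¬separated⇒⊑ : ∀ {a b} → ¬ Separated a b → a ⊑ b
  ¬separated⇒⊑ ¬sep γ γa∈L = em⇒dne em λ γb∉L → ¬sep (γ , γa∈L , γb∉L)

  separator : ∀ {a b} → Dec (Separated a b) → Subset 𝒜
  separator (yes (γ , _)) = preimage 𝒜 γ L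
  separator (no _)        = U

  separator-∈ : ∀ {a b} (d : Dec (Separated a b)) → Latt∅A 𝒜 L (separator d)
  separator-∈ (yes (γ , _)) = pre γ base
  separator-∈ (no _)        = full

  ↑⊆separator : ∀ {a b} (d : Dec (Separated a b)) → (a ⊑_) ⊆ separator d
  ↑⊆separator (yes (γ , γa∈L , _)) a⊑x = a⊑x γ γa∈L
  ↑⊆separator (no _)               _   = _

  separator∩class⊆↑ : ∀ {a} j (d : Dec (Separated a (r j))) → separator d ∩ (_≈ r j) ⊆ (a ⊑_)
  separator∩class⊆↑ j (yes (γ , _ , γrj∉L)) (x∈γ⁻¹L , x≈rj) =
    ⊥-elim (γrj∉L (L-saturated _ _ (apply*-cong 𝒜 θ γ x≈rj) x∈γ⁻¹L))
  separator∩class⊆↑ j (no ¬sep) (_ , x≈rj) =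
    ⊑-trans (¬separated⇒⊑ ¬sep) (≈⇒⊑ (≈-sym x≈rj))

  ↑-latt∅A : ∀ a → Latt∅A 𝒜 L (a ⊑_)
  ↑-latt∅A a =
    ⋂-localization latt∅A-isSetLattice (λ j → separator (em {Separated a (r j)}))
                   (λ j → separator-∈ em) (λ j → ↑⊆separator em) (λ j → separator∩class⊆↑ j em)

  respects-⊑⇒latt∅A : ∀ {X} → X Respects _⊑_ → Latt∅A 𝒜 L X
  respects-⊑⇒latt∅A = respects⇒∈ em latt∅A-isSetLattice _⊑_ ≈⇒⊑ ↑-latt∅A

  -- a ~ x iff a ⊑ x and x lies outside the up-closed set of those y with y ⋢ a
  class-bool∅A : ∀ a → Bool∅A 𝒜 L (a ~_)
  class-bool∅A a =
    ext (⊆-antisym 𝒜 (λ (a⊑x , ¬¬x⊑a) → a⊑x , em⇒dne em ¬¬x⊑a)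
                     (λ (a⊑x , x⊑a) → a⊑x , λ x⋢a → x⋢a x⊑a))
        (inter (latt∅A⊆bool∅A (↑-latt∅A a))
               (compl (latt∅A⊆bool∅A (respects-⊑⇒latt∅A λ x⊑y x⋢a y⊑a → x⋢a (⊑-trans x⊑y y⊑a)))))

  respects-~⇒bool∅A : ∀ {X} → X Respects _~_ → Bool∅A 𝒜 L X
  respects-~⇒bool∅A = respects⇒∈ em bool∅A-isSetLattice _~_ ≈⇒~ class-bool∅A

  bool∞-recognizable : ∀ X → Bool∞ 𝒜 L X → Recognizable 𝒜 X
  bool∞-recognizable X X∈ = θ , (n , r , cover) , λ a b a≈b → bool∞-respects-~ X∈ (≈⇒~ a≈b)

  cell : (Fin n → Fin 2) → Subset 𝒜
  cell s = ⋃ (Fin n) λ j a → s j ≡ zero × r j ~ a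

  cell-respects-~ : ∀ s → cell s Respects _~_
  cell-respects-~ s a~b (j , sj≡0 , rj~a) = j , sj≡0 , ~-trans rj~a a~b

  ≐cell : ∀ {X} s → X Respects _~_ →
    (∀ j → s j ≡ zero → X (r j)) → (∀ j → X (r j) → s j ≡ zero) → _≐_ 𝒜 X (cell s)
  ≐cell s X-resp selected⇒∈ ∈⇒selected a with ⋃-representatives _~_ ≈⇒~ X-resp a
  ... | to , from =
    (λ a∈X → let (j , rj∈X , rj~a) = to a∈X in j , ∈⇒selected j rj∈X , rj~a) ,
    (λ (j , sj≡0 , rj~a) → from (j , selected⇒∈ j sj≡0 , rj~a))

  bool∞-finite : FiniteFamily 𝒜 (Bool∞ 𝒜 L)
  bool∞-finite =
    2 ^ n , cell ∘ finToFun ,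
    (λ i → bool∅A⊆bool∞ (respects-~⇒bool∅A (cell-respects-~ (finToFun i)))) ,
    λ X X∈ → let X-resp = bool∞-respects-~ X∈
                 χ j = fromDec (em {X (r j)})
                 χ≗ = finToFun-funToFin χ in
      funToFin χ ,
      ≐cell _ X-resp (λ j sj≡0 → fromDec≡zero⇒ em (trans (sym (χ≗ j)) sj≡0))
                     (λ j rj∈X → trans (χ≗ j) (⇒fromDec≡zero em rj∈X))

lemma4p7 : ExcludedMiddle 0ℓ → (𝒜 : Algebra) (L : Subset 𝒜) → Recognizable 𝒜 L →
    FiniteFamily 𝒜 (Bool∞ 𝒜 L)
    × (∀ X → Bool∞ 𝒜 L X → Recognizable 𝒜 X)
    × SameFamily 𝒜 (Latt∅A 𝒜 L) (Latt∞ 𝒜 L)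
    × SameFamily 𝒜 (Bool∅A 𝒜 L) (Bool∞ 𝒜 L)
lemma4p7 em 𝒜 L (θ , (n , r , cover) , L-saturated) =
  bool∞-finite ,
  bool∞-recognizable ,
  (λ X → latt∅A⊆latt∞ , respects-⊑⇒latt∅A ∘ latt∞-respects-⊑) ,
  (λ X → bool∅A⊆bool∞ , respects-~⇒bool∅A ∘ bool∞-respects-~)
  where
  open Closures 𝒜 L
  open SyntacticPreorder 𝒜 L
  open Recognized em 𝒜 L θ n r cover L-saturated
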